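{- Consider the amortized tree-buffer algorithm described in the context. There exist constants $c, C>0$ such that for every valid sequence consisting of $\mathrm{initialize}(x_0)$ followed by $\ell$ modifying operations: (i) the total running time of the $\ell$ modifying operations is at most $c\cdot \ell$; (ii) for all $k\le \ell$, $s_{\mathrm{amo}}(k)\le C\cdot \max_{0\le j\le k} |H^{(j)}_{<h}|$; (iii) if the sequence is extensive, then for all $k\le\ell$, $s_{\mathrm{amo}}(k)\le C\cdot |H^{(k)}_{<h}|$.
   Context: Fix an integer $h\ge 1$. Reference semantics of a tree buffer: a valid sequence of operations is $\mathrm{initialize}(x_0)$ followed by finitely many modifying operations, each of the form $\mathrm{add\_child}(x,y)$ or $\mathrm{deactivate}(x)$. The reference semantics maintains a rooted tree $T$ and a set $\mathrm{Active}\subseteq T$: $\mathrm{initialize}(x_0)$ creates the tree with single node $x_0$ (the root) and sets $\mathrm{Active}=\{x_0\}$; $\mathrm{add\_child}(x,y)$ is allowed only if $x\in\mathrm{Active}$ and $y$ is a fresh node not in $T$, and it adds $y$ to $T$ as a child of $x$ and adds $y$ to $\mathrm{Active}$; $\mathrm{deactivate}(x)$ removes $x$ from $\mathrm{Active}$ (nodes are never removed from $T$). $T^{(k)}$, $\mathrm{Active}^{(k)}$ denote the tree and active set after the initialize and the first $k$ modifying operations. The subtree of $x$ consists of $x$ and all its descendants. The height of a node $x\in T$ is the minimum distance from $x$ to an active node in the subtree of $x$ ($0$ if $x$ is active, $\infty$ if the subtree contains no active node). $H_i$ is the set of nodes of height $i$ and $H_{<i}$ the set of nodes of height $<i$; $H^{(k)}_i$,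 $H^{(k)}_{<i}$ refer to $T^{(k)}$ with $\mathrm{Active}^{(k)}$. A sequence is extensive if every $\mathrm{deactivate}(x)$ in it is immediately preceded by $\mathrm{add\_child}(x,y)$ for some $y$. Amortized algorithm: it keeps a set of nodes in memory (with parent pointers), the set Active, and counters $\mathrm{mem}$ (number of nodes in memory) and $\mathrm{mem}_{\mathrm{old}}$; after $\mathrm{initialize}(x_0)$ the memory is $\{x_0\}$ and $\mathrm{mem}=\mathrm{mem}_{\mathrm{old}}=1$. $\mathrm{add\_child}(x,y)$ puts $y$ in memory as a child of $x$, adds $y$ to Active, increments $\mathrm{mem}$, and then, if $\mathrm{mem}=2\cdot\mathrm{mem}_{\mathrm{old}}$, performs a garbage collection, which deletes from memory every node not in $H_{<h}$ of the current tree (so that afterwards $\mathrm{mem}=|H_{<h}|$), and then sets $\mathrm{mem}_{\mathrm{old}}:=\mathrm{mem}$. $\mathrm{deactivate}(x)$ only removes $x$ from Active. Cost model: every modifying operation that does not trigger a garbage collection takes at most a fixed constant time $c_1$, and a garbage collection takes time at most $c_2\cdot\mathrm{mem}$, where $\mathrm{mem}$ is its value when the collection is triggered and $c_2$ is a fixed constant. $s_{\mathrm{amo}}(k)$ denotes the number of nodes in memory (the value of $\mathrm{mem}$) after the first $k$ modifying operations. -}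

module Defs where

open import Data.Nat using (ℕ; zero; suc; _+_; _*_; _≤_; _<_; _⊔_; _≟_; _≡ᵇ_)
open import Data.Bool using (Bool; true; false; if_then_else_)
open import Data.Fin using (Fin; toℕ)
open import Data.Fin.Properties as FinP using ()
open import Data.List using (List; []; _∷_; map; filter; length)
open import Data.List.Relation.Unary.Any using (Any; any?)
open import Data.List.Membership.Propositional using (_∈_; _∉_)
open import Data.Product using (Σ; ∃; _×_; _,_; proj₁; proj₂)
open import Relation.Binary.PropositionalEquality using (_≡_)
open import Relation.Nullary using (Dec; yes; no; ¬_)
open import Relation.Nullary.Decidable using (_×-dec_)

-- Trees.  Nodes are natural numbers (arbitrary labels).  A tree is
-- given by its root and its list of edges (child , parent).

record Tree : Set where
  constructor mkTree
  field
    root  : ℕ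
    edges : List (ℕ × ℕ)
open Tree public

nodes : Tree → List ℕ
nodes t = root t ∷ map proj₁ (edges t)

-- DescAt t x y d : y is a descendant of x at distance d
-- (i.e. following parent pointers d times from y reaches x).
DescAt : Tree → ℕ → ℕ → ℕ → Set
DescAt t x y zero    = x ≡ y
DescAt t x y (suc d) = Any (λ e → (proj₁ e ≡ y) × DescAt t x (proj₂ e) d) (edges t)

descAt? : (t : Tree) (x y d : ℕ) → Dec (DescAt t x y d)
descAt? t x y zero    = x ≟ y
descAt? t x y (suc d) =
  any? (λ e → (proj₁ e ≟ y) ×-dec descAt? t x (proj₂ e) d) (edges t)

-- x ∈ H_{<i}: the height of x (minimum distance from x to an active
-- node in its subtree) is < i, i.e. some active node lies in the
-- subtree of x at distance < i.
InHlt : Tree → List ℕ → ℕ → ℕ → Set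
InHlt t act i x = Any (λ y → Σ (Fin i) λ d → DescAt t x y (toℕ d)) act

inHlt? : (t : Tree) (act : List ℕ) (i x : ℕ) → Dec (InHlt t act i x)
inHlt? t act i x = any? (λ y → FinP.any? (λ d → descAt? t x y (toℕ d))) act

sizeHlt : Tree → List ℕ → ℕ → ℕ
sizeHlt t act i = length (filter (inHlt? t act i) (nodes t))

data Op : Set where
  addChild   : ℕ → ℕ → Op
  deactivate : ℕ → Op

-- Combined state: reference semantics (tree, Active) plus the memory
-- and counters of the amortized algorithm.
record State : Set where
  constructor mkState
  field
    tree   : Tree
    active : List ℕ
    memory : List ℕ
    mem    : ℕ
    memOld : ℕ
open State public

initState : ℕ → State
initState x₀ = mkState (mkTree x₀ []) (x₀ ∷ []) (x₀ ∷ []) 1 1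

removeAll : ℕ → List ℕ → List ℕ
removeAll x = filter (λ z → Relation.Nullary.¬? (z ≟ x))

triggersGC : State → Op → Bool
triggersGC s (addChild x y) = suc (mem s) ≡ᵇ 2 * memOld s
triggersGC s (deactivate x) = false

step : ℕ → State → Op → State
step h s (addChild x y) =
  let t'   = mkTree (root (tree s)) ((y , x) ∷ edges (tree s))
      act' = y ∷ active s
      mry' = y ∷ memory s
      m'   = suc (mem s)
  in if m' ≡ᵇ 2 * memOld s
     then (let gc = filter (inHlt? t' act' h) mry'
           in mkState t' act' gc (length gc) (length gc))
     else mkState t' act' mry' m' (memOld s)
step h s (deactivate x) =
  mkState (tree s) (removeAll x (active s)) (memory s) (mem s) (memOld s)

-- state after initialize(x₀) and the first k operations op 0 … op (k-1)
stateAt : ℕ → ℕ → (ℕ → Op) → ℕ → State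
stateAt h x₀ op zero    = initState x₀
stateAt h x₀ op (suc k) = step h (stateAt h x₀ op k) (op k)

ValidOp : State → Op → Set
ValidOp s (addChild x y) = (x ∈ active s) × (y ∉ nodes (tree s))
ValidOp s (deactivate x) = Data.Unit.⊤
  where import Data.Unit

Valid : ℕ → ℕ → ℕ → (ℕ → Op) → Set
Valid h x₀ ℓ op = ∀ k → k < ℓ → ValidOp (stateAt h x₀ op k) (op k)

Extensive : ℕ → (ℕ → Op) → Set
Extensive ℓ op = ∀ k x → k < ℓ → op k ≡ deactivate x →
  Σ ℕ λ j → (k ≡ suc j) × Σ ℕ λ y → op j ≡ addChild x y

-- cost model: time k is the running time of operation op k
CostOK : ℕ → ℕ → ℕ → ℕ → ℕ → (ℕ → Op) → (ℕ → ℕ) → Set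
CostOK c₁ c₂ h x₀ ℓ op time = ∀ k → k < ℓ →
  let s = stateAt h x₀ op k in
  if triggersGC s (op k)
  then time k ≤ c₂ * suc (mem s)   -- mem at the moment the collection is triggered
  else time k ≤ c₁

sumTo : (ℕ → ℕ) → ℕ → ℕ
sumTo f zero    = 0
sumTo f (suc n) = sumTo f n + f n

maxTo : (ℕ → ℕ) → ℕ → ℕ
maxTo f zero    = f 0
maxTo f (suc k) = maxTo f k ⊔ f (suc k)

sAmo : ℕ → ℕ → (ℕ → Op) → ℕ → ℕ
sAmo h x₀ op k = mem (stateAt h x₀ op k)

hSize : ℕ → ℕ → (ℕ → Op) → ℕ → ℕ
hSize h x₀ op k = let s = stateAt h x₀ op k in sizeHlt (tree s) (active s) h

-- Time: with the potential 2c₂(mem − memOld) every operation has amortized cost at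
-- most c₁ + 2c₂, since a collection is triggered only when mem + 1 = 2·memOld and then
-- costs c₂(mem + 1), which is the potential plus 2c₂, while resetting the potential to 0.
-- Space: mem < 2·memOld always, and memOld is 1 or the size of the memory right after
-- the last collection, i.e. of a duplicate-free list of nodes of height < h; so
-- s_amo(k) < 2·max_{j ≤ k} |H^{(j)}_{<h}|.  In an extensive run, add_child(x, y) makes
-- |H_{<h}| grow by at least one (y is new and heights only decrease), and the
-- deactivate(x) that may follow removes at most one node from H_{<h}: one whose only
-- nearby active descendant was x, at distance exactly h − 1 (the active child y is at
-- distance h), and x has a unique ancestor at that distance.  Hence |H^{(k)}_{<h}| stays
-- within one of its running maximum and positive, so that maximum is at most
-- 2|H^{(k)}_{<h}|.

module Submission where

open import Defs
open import Data.Bool using (true; false; T; if_then_else_)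
open import Function using (_∘_)
open import Data.Empty using (⊥-elim)
open import Data.Fin as Fin using (Fin; toℕ; fromℕ<)
open import Data.Fin.Properties using (toℕ-fromℕ<; toℕ≤pred[n])
open import Data.List using (List; []; _∷_; _++_; filter; length; map)
open import Data.List.Properties using (length-removeAt′; filter-none; filter-accept)
open import Data.List.Membership.Propositional using (_∈_; _∉_; _─_; find; lose)
open import Data.List.Membership.Propositional.Properties using (∈-filter⁺; ∈-map⁺)
open import Data.List.Relation.Binary.Subset.Propositional using (_⊆_)
open import Data.List.Relation.Binary.Subset.Propositional.Properties
  using (⊆-trans; ∷⁺ʳ; xs⊆x∷xs; ∈-∷⁺ʳ; filter-⊆; filter⁺′)
open import Data.List.Relation.Unary.All as All using ([]; _∷_)
open import Data.List.Relation.Unary.All.Properties using (¬Any⇒All¬)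
open import Data.List.Relation.Unary.AllPairs using ([]; _∷_)
open import Data.List.Relation.Unary.Any using (here; there; index)
open import Data.List.Relation.Unary.Unique.Propositional using (Unique)
import Data.List.Relation.Unary.Unique.Propositional.Properties as Unique
import Data.List.Relation.Binary.Sublist.Propositional as Sublist
import Data.List.Relation.Binary.Sublist.Propositional.Properties as Sublist
open import Data.Nat
open import Data.Nat.Properties
open import Data.Nat.Tactic.RingSolver using (solve-∀)
open import Data.Product using (Σ; _×_; _,_; proj₁)
open import Data.Sum using (_⊎_; inj₁; inj₂)
open import Level using (0ℓ)
open import Relation.Binary.PropositionalEquality
open import Relation.Nullary using (yes; no; ¬?)
open import Relation.Unary using (Pred; Decidable)

private
  variable
    A : Set

-- Counting in duplicate-free lists

count : {P : Pred A 0ℓ} → Decidable P → List A → ℕ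
count P? xs = length (filter P? xs)

∈-─⁺ : ∀ {x z : A} {ys} (x∈ys : x ∈ ys) → z ∈ ys → z ≢ x → z ∈ ys ─ x∈ys
∈-─⁺ (here refl) (here refl) z≢x = ⊥-elim (z≢x refl)
∈-─⁺ (here refl) (there z∈ys) _  = z∈ys
∈-─⁺ (there _)   (here refl)  _  = here refl
∈-─⁺ (there x∈ys) (there z∈ys) z≢x = there (∈-─⁺ x∈ys z∈ys z≢x)

Unique⇒length-≤ : ∀ {xs ys : List A} → Unique xs → xs ⊆ ys → length xs ≤ length ys
Unique⇒length-≤ {xs = []} _ _ = z≤n
Unique⇒length-≤ {xs = x ∷ xs} {ys} (x∉xs ∷ u) xs⊆ys = begin
  suc (length xs)          ≤⟨ s≤s (Unique⇒length-≤ u xs⊆ys─x) ⟩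
  suc (length (ys ─ x∈ys)) ≡⟨ length-removeAt′ ys (index x∈ys) ⟨
  length ys                ∎
  where
  open ≤-Reasoning
  x∈ys = xs⊆ys (here refl)
  xs⊆ys─x : xs ⊆ ys ─ x∈ys
  xs⊆ys─x z∈xs = ∈-─⁺ x∈ys (xs⊆ys (there z∈xs)) (≢-sym (All.lookup x∉xs z∈xs))

count-mono : {P Q : Pred A 0ℓ} (P? : Decidable P) (Q? : Decidable Q) →
  (∀ {z} → P z → Q z) → (xs : List A) → count P? xs ≤ count Q? xs
count-mono P? Q? P⇒Q xs =
  Sublist.length-mono-≤ (Sublist.filter⁺ P? Q? (λ { refl → P⇒Q }) (Sublist.⊆-refl {x = xs}))

count-∷-≤ : {P : Pred A 0ℓ} (P? : Decidable P) (x : A) (xs : List A) →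
  count P? xs ≤ count P? (x ∷ xs)
count-∷-≤ P? x xs with P? x
... | yes _ = n≤1+n _
... | no _  = ≤-refl

count-accept : {P : Pred A 0ℓ} (P? : Decidable P) {x : A} → P x →
  (xs : List A) → count P? (x ∷ xs) ≡ suc (count P? xs)
count-accept P? px xs = cong length (filter-accept P? px)

count-insert : {P : Pred A 0ℓ} (P? : Decidable P) {y : A} → P y →
  (xs ys : List A) → count P? (xs ++ y ∷ ys) ≡ suc (count P? (xs ++ ys))
count-insert P? py [] ys = count-accept P? py ys
count-insert P? py (x ∷ xs) ys with P? x
... | yes _ = cong suc (count-insert P? py xs ys)
... | no _  = count-insert P? py xs ys

count-∪ : {P Q L : Pred A 0ℓ} (P? : Decidable P) (Q? : Decidable Q) (L? : Decidable L) →
  (∀ {z} → P z → Q z ⊎ L z) → (xs : List A) → count P? xs ≤ count Q? xs + count L? xs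
count-∪ P? Q? L? P⇒Q∪L [] = z≤n
count-∪ P? Q? L? P⇒Q∪L (x ∷ xs) with P? x
... | no _ = ≤-trans (count-∪ P? Q? L? P⇒Q∪L xs) (+-mono-≤ (count-∷-≤ Q? x xs) (count-∷-≤ L? x xs))
... | yes p with P⇒Q∪L p
...   | inj₁ q = begin
  suc (count P? xs)                        ≤⟨ s≤s (count-∪ P? Q? L? P⇒Q∪L xs) ⟩
  suc (count Q? xs + count L? xs)          ≤⟨ s≤s (+-monoʳ-≤ (count Q? xs) (count-∷-≤ L? x xs)) ⟩
  suc (count Q? xs) + count L? (x ∷ xs)    ≡⟨ cong (_+ count L? (x ∷ xs)) (count-accept Q? q xs) ⟨
  count Q? (x ∷ xs) + count L? (x ∷ xs)    ∎
  where open ≤-Reasoning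
...   | inj₂ l = begin
  suc (count P? xs)                        ≤⟨ s≤s (count-∪ P? Q? L? P⇒Q∪L xs) ⟩
  suc (count Q? xs + count L? xs)          ≤⟨ s≤s (+-monoˡ-≤ (count L? xs) (count-∷-≤ Q? x xs)) ⟩
  suc (count Q? (x ∷ xs) + count L? xs)    ≡⟨ +-suc (count Q? (x ∷ xs)) (count L? xs) ⟨
  count Q? (x ∷ xs) + suc (count L? xs)    ≡⟨ cong (count Q? (x ∷ xs) +_) (count-accept L? l xs) ⟨
  count Q? (x ∷ xs) + count L? (x ∷ xs)    ∎
  where open ≤-Reasoning

count-≤1 : {L : Pred A 0ℓ} (L? : Decidable L) → (∀ {z z′} → L z → L z′ → z ≡ z′) →
  {xs : List A} → Unique xs → count L? xs ≤ 1
count-≤1 L? L-unique {[]} _ = z≤n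
count-≤1 L? L-unique {x ∷ xs} (x∉xs ∷ u) with L? x
... | yes l = s≤s (≤-reflexive (cong length (filter-none L? (All.map (λ x≢z lz → x≢z (L-unique l lz)) x∉xs))))
... | no _  = count-≤1 L? L-unique u

-- Heights in trees

parent-unique : {B : Set} {es : List (A × B)} {c : A} {p p′ : B} →
  Unique (map proj₁ es) → (c , p) ∈ es → (c , p′) ∈ es → p ≡ p′
parent-unique _          (here refl) (here refl) = refl
parent-unique (c∉es ∷ _) (here refl) (there q)   = ⊥-elim (All.lookup c∉es (∈-map⁺ proj₁ q) refl)
parent-unique (c∉es ∷ _) (there q)   (here refl) = ⊥-elim (All.lookup c∉es (∈-map⁺ proj₁ q) refl)
parent-unique (_ ∷ u)    (there q)   (there q′)  = parent-unique u q q′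

DescAt-mono : ∀ {t t′} → edges t ⊆ edges t′ → ∀ {x y} d → DescAt t x y d → DescAt t′ x y d
DescAt-mono sub zero    x≡y = x≡y
DescAt-mono sub (suc d) D with find D
... | _ , e∈ , e↦y , D′ = lose (sub e∈) (e↦y , DescAt-mono sub d D′)

DescAt-child : ∀ {t x y z d} → (y , x) ∈ edges t → DescAt t z x d → DescAt t z y (suc d)
DescAt-child e∈ D = lose e∈ (refl , D)

ancestor-unique : ∀ {t} → Unique (map proj₁ (edges t)) →
  ∀ {z z′ x} d → DescAt t z x d → DescAt t z′ x d → z ≡ z′
ancestor-unique u zero    z≡x z′≡x = trans z≡x (sym z′≡x)
ancestor-unique {t} u (suc d) D D′ with find D | find D′
... | (_ , p) , e∈ , refl , Dp | (_ , p′) , e′∈ , refl , Dp′ =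
  ancestor-unique u d Dp (subst (λ q → DescAt t _ q d) (sym (parent-unique u e∈ e′∈)) Dp′)

InHlt-mono : ∀ {t t′ act act′ i z} → edges t ⊆ edges t′ → act ⊆ act′ →
  InHlt t act i z → InHlt t′ act′ i z
InHlt-mono sub act⊆ p with find p
... | _ , a∈ , d , D = lose (act⊆ a∈) (d , DescAt-mono sub (toℕ d) D)

InHlt-removeAll : ∀ {t act h x y} → y ∈ act → y ≢ x → (y , x) ∈ edges t → ∀ {z} →
  InHlt t act (suc h) z → InHlt t (removeAll x act) (suc h) z ⊎ DescAt t z x h
InHlt-removeAll {t} {act} {h} {x} {y} y∈ y≢x e∈ {z} p with find p
... | a , a∈ , d , D with a ≟ x
...   | no a≢x = inj₁ (lose (∈-filter⁺ (λ w → ¬? (w ≟ x)) a∈ a≢x) (d , D))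
...   | yes refl with m≤n⇒m<n∨m≡n (toℕ≤pred[n] d)
...     | inj₂ d≡h = inj₂ (subst (DescAt t z a) d≡h D)
...     | inj₁ d<h = inj₁ (lose (∈-filter⁺ (λ w → ¬? (w ≟ a)) y∈ y≢x) (d′ , D′))
  where
  -- the active child y is then a witness at distance d + 1 ≤ h
  d′ : Fin (suc h)
  d′ = fromℕ< (s≤s d<h)
  D′ : DescAt t z y (toℕ d′)
  D′ = subst (DescAt t z y) (sym (toℕ-fromℕ< (s≤s d<h))) (DescAt-child e∈ D)

addEdge : Tree → ℕ → ℕ → Tree
addEdge t x y = mkTree (root t) ((y , x) ∷ edges t)

nodes-addEdge-unique : ∀ t x {y} → Unique (nodes t) → y ∉ nodes t → Unique (nodes (addEdge t x y))
nodes-addEdge-unique t x {y} (r∉ ∷ u) y∉ =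
  ((λ r≡y → y∉ (here (sym r≡y))) ∷ r∉) ∷ (¬Any⇒All¬ _ (y∉ ∘ there) ∷ u)

nodes-⊆-addEdge : ∀ t x y → nodes t ⊆ nodes (addEdge t x y)
nodes-⊆-addEdge t x y = ∷⁺ʳ (root t) (xs⊆x∷xs _ y)

sizeHlt-addChild : ∀ t act h x y → suc (sizeHlt t act (suc h)) ≤ sizeHlt (addEdge t x y) (y ∷ act) (suc h)
sizeHlt-addChild t act h x y = begin
  suc (count P? (root t ∷ rest))     ≤⟨ s≤s (count-mono P? P′? (InHlt-mono there there) (root t ∷ rest)) ⟩
  suc (count P′? (root t ∷ rest))    ≡⟨ count-insert P′? (here (Fin.zero , refl)) (root t ∷ []) rest ⟨
  count P′? (root t ∷ y ∷ rest)      ∎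
  where
  open ≤-Reasoning
  rest = map proj₁ (edges t)
  P?  = inHlt? t act (suc h)
  P′? = inHlt? (addEdge t x y) (y ∷ act) (suc h)

sizeHlt-removeAll : ∀ {t act h x y} → Unique (nodes t) → y ∈ act → y ≢ x → (y , x) ∈ edges t →
  sizeHlt t act (suc h) ≤ suc (sizeHlt t (removeAll x act) (suc h))
sizeHlt-removeAll {t} {act} {h} {x} u@(_ ∷ u-edges) y∈ y≢x e∈ = begin
  sizeHlt t act (suc h)    ≤⟨ count-∪ P? Q? L? (InHlt-removeAll y∈ y≢x e∈) (nodes t) ⟩
  n + count L? (nodes t)   ≤⟨ +-monoʳ-≤ n (count-≤1 L? (ancestor-unique u-edges h) u) ⟩
  n + 1                    ≡⟨ +-comm n 1 ⟩
  suc n                    ∎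
  where
  open ≤-Reasoning
  n = sizeHlt t (removeAll x act) (suc h)
  P? = inHlt? t act (suc h)
  Q? = inHlt? t (removeAll x act) (suc h)
  L? = λ z → descAt? t z x h

-- Invariants of the amortized algorithm

sizeHltOf : ℕ → State → ℕ
sizeHltOf i s = sizeHlt (tree s) (active s) i

length-filter-inHlt≤sizeHlt : ∀ {t act i ms} → Unique ms → ms ⊆ nodes t →
  length (filter (inHlt? t act i) ms) ≤ sizeHlt t act i
length-filter-inHlt≤sizeHlt {t} {act} {i} u ms⊆ =
  Unique⇒length-≤ (Unique.filter⁺ P? u) (filter⁺′ P? P? (λ p → p) ms⊆)
  where P? = inHlt? t act i

record Invariant (s : State) : Set where
  field
    nodes-unique  : Unique (nodes (tree s))
    active⊆nodes  : active s ⊆ nodes (tree s)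
    memory-unique : Unique (memory s)
    memory⊆nodes  : memory s ⊆ nodes (tree s)
    mem<2memOld   : mem s < 2 * memOld s
open Invariant

Invariant-init : ∀ x₀ → Invariant (initState x₀)
Invariant-init x₀ = record
  { nodes-unique = [] ∷ []
  ; active⊆nodes = λ a∈ → a∈
  ; memory-unique = [] ∷ []
  ; memory⊆nodes = λ a∈ → a∈
  ; mem<2memOld = s≤s (s≤s z≤n)
  }

module _ {s : State} {y : ℕ} (inv : Invariant s) (y∉ : y ∉ nodes (tree s)) where

  y∷memory-unique : Unique (y ∷ memory s)
  y∷memory-unique = ¬Any⇒All¬ _ (y∉ ∘ memory⊆nodes inv) ∷ memory-unique inv

  y∷memory⊆nodes : ∀ x → y ∷ memory s ⊆ nodes (addEdge (tree s) x y)
  y∷memory⊆nodes x = ∈-∷⁺ʳ (there (here refl)) (⊆-trans (memory⊆nodes inv) (nodes-⊆-addEdge (tree s) x y))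

  y∷active⊆nodes : ∀ x → y ∷ active s ⊆ nodes (addEdge (tree s) x y)
  y∷active⊆nodes x = ∈-∷⁺ʳ (there (here refl)) (⊆-trans (active⊆nodes inv) (nodes-⊆-addEdge (tree s) x y))

≡ᵇ-true⇒≡ : ∀ {m n} → (m ≡ᵇ n) ≡ true → m ≡ n
≡ᵇ-true⇒≡ {m} {n} e = ≡ᵇ⇒≡ m n (subst T (sym e) _)

≡ᵇ-false⇒≢ : ∀ {m n} → (m ≡ᵇ n) ≡ false → m ≢ n
≡ᵇ-false⇒≢ {m} {n} e m≡n = subst T e (≡⇒≡ᵇ m n m≡n)

module _ (h : ℕ) where

  tree-addChild : ∀ s x y → tree (step (suc h) s (addChild x y)) ≡ addEdge (tree s) x y
  tree-addChild s x y with suc (mem s) ≡ᵇ 2 * memOld s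
  ... | true  = refl
  ... | false = refl

  active-addChild : ∀ s x y → active (step (suc h) s (addChild x y)) ≡ y ∷ active s
  active-addChild s x y with suc (mem s) ≡ᵇ 2 * memOld s
  ... | true  = refl
  ... | false = refl

  Invariant-step : ∀ {s} o → Invariant s → ValidOp s o → Invariant (step (suc h) s o)
  Invariant-step (deactivate x) inv _ = record
    { nodes-unique  = nodes-unique inv
    ; active⊆nodes  = active⊆nodes inv ∘ filter-⊆ (λ z → ¬? (z ≟ x)) _
    ; memory-unique = memory-unique inv
    ; memory⊆nodes  = memory⊆nodes inv
    ; mem<2memOld   = mem<2memOld inv
    }
  Invariant-step {s} (addChild x y) inv (_ , y∉) with suc (mem s) ≡ᵇ 2 * memOld s in gc
  ... | false = record
    { nodes-unique  = nodes-addEdge-unique (tree s) x (nodes-unique inv) y∉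
    ; active⊆nodes  = y∷active⊆nodes inv y∉ x
    ; memory-unique = y∷memory-unique inv y∉
    ; memory⊆nodes  = y∷memory⊆nodes inv y∉ x
    ; mem<2memOld   = ≤∧≢⇒< (mem<2memOld inv) (≡ᵇ-false⇒≢ gc)
    }
  ... | true = record
    { nodes-unique  = nodes-addEdge-unique (tree s) x (nodes-unique inv) y∉
    ; active⊆nodes  = y∷active⊆nodes inv y∉ x
    ; memory-unique = Unique.filter⁺ P? (y∷memory-unique inv y∉)
    ; memory⊆nodes  = y∷memory⊆nodes inv y∉ x ∘ filter-⊆ P? _
    ; mem<2memOld   = subst (λ L → L < 2 * L) (sym survivors) (m<m+n (suc _) z<s)
    }
    where
    P? = inHlt? (addEdge (tree s) x y) (y ∷ active s) (suc h)
    survivors : length (filter P? (y ∷ memory s)) ≡ suc (count P? (memory s))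
    survivors = count-accept P? (here (Fin.zero , refl)) (memory s)

  memOld-step : ∀ {s} o → Invariant s → ValidOp s o →
    memOld (step (suc h) s o) ≡ memOld s ⊎ memOld (step (suc h) s o) ≤ sizeHltOf (suc h) (step (suc h) s o)
  memOld-step (deactivate x) _ _ = inj₁ refl
  memOld-step {s} (addChild x y) inv (_ , y∉) with suc (mem s) ≡ᵇ 2 * memOld s
  ... | false = inj₁ refl
  ... | true  = inj₂ (length-filter-inHlt≤sizeHlt {act = y ∷ active s} {i = suc h}
                       (y∷memory-unique inv y∉) (y∷memory⊆nodes inv y∉ x))

  sizeHltOf-addChild : ∀ s x y → suc (sizeHltOf (suc h) s) ≤ sizeHltOf (suc h) (step (suc h) s (addChild x y))
  sizeHltOf-addChild s x y rewrite tree-addChild s x y | active-addChild s x y =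
    sizeHlt-addChild (tree s) (active s) h x y

  sizeHltOf-deactivate-child : ∀ {s x y} → Invariant s → ValidOp s (addChild x y) →
    let s′ = step (suc h) s (addChild x y) in
    sizeHltOf (suc h) s′ ≤ suc (sizeHltOf (suc h) (step (suc h) s′ (deactivate x)))
  sizeHltOf-deactivate-child {s} {x} {y} inv valid@(x∈ , y∉) =
    sizeHlt-removeAll (nodes-unique (Invariant-step (addChild x y) inv valid)) y∈ y≢x e∈
    where
    y≢x : y ≢ x
    y≢x refl = y∉ (active⊆nodes inv x∈)
    y∈ : y ∈ active (step (suc h) s (addChild x y))
    y∈ = subst (y ∈_) (sym (active-addChild s x y)) (here refl)
    e∈ : (y , x) ∈ edges (tree (step (suc h) s (addChild x y)))
    e∈ = subst (λ t → (y , x) ∈ edges t) (sym (tree-addChild s x y)) (here refl)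

-- Running time

suc-∸-≤ : ∀ m n → suc m ∸ n ≤ suc (m ∸ n)
suc-∸-≤ m n = m≤n+o⇒m∸n≤o (suc m) n (subst (suc m ≤_) (sym (+-suc n (m ∸ n))) (s≤s (m≤n+m∸n m n)))

potential : ℕ → State → ℕ
potential c₂ s = 2 * c₂ * (mem s ∸ memOld s)

gc-cost : ∀ c m o → suc m ≡ 2 * o → c * suc m ≡ 2 * c * (m ∸ o) + 2 * c
gc-cost c m (suc o) suc-m≡2o = begin
  c * suc m                      ≡⟨ cong (λ k → c * suc k) m≡o+suc-o ⟩
  c * suc (o + suc o)            ≡⟨ ring c o ⟩
  2 * c * o + 2 * c              ≡⟨ cong (λ k → 2 * c * k + 2 * c) (m+n∸n≡m o (suc o)) ⟨
  2 * c * (o + suc o ∸ suc o) + 2 * c ≡⟨ cong (λ k → 2 * c * (k ∸ suc o) + 2 * c) m≡o+suc-o ⟨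
  2 * c * (m ∸ suc o) + 2 * c    ∎
  where
  open ≡-Reasoning
  m≡o+suc-o : m ≡ o + suc o
  m≡o+suc-o = trans (suc-injective suc-m≡2o) (cong (λ k → o + suc k) (+-identityʳ o))
  ring : ∀ c o → c * suc (o + suc o) ≡ 2 * c * o + 2 * c
  ring = solve-∀

amortized-step : ∀ h c₁ c₂ s o t →
  (if triggersGC s o then t ≤ c₂ * suc (mem s) else t ≤ c₁) →
  t + potential c₂ (step h s o) ≤ potential c₂ s + (c₁ + 2 * c₂)
amortized-step h c₁ c₂ s (deactivate x) t t≤c₁ = begin
  t + potential c₂ s            ≤⟨ +-monoˡ-≤ _ t≤c₁ ⟩
  c₁ + potential c₂ s           ≡⟨ +-comm c₁ _ ⟩
  potential c₂ s + c₁           ≤⟨ +-monoʳ-≤ _ (m≤m+n c₁ _) ⟩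
  potential c₂ s + (c₁ + 2 * c₂) ∎
  where open ≤-Reasoning
amortized-step h c₁ c₂ s (addChild x y) t t≤ with suc (mem s) ≡ᵇ 2 * memOld s in gc
... | false = begin
  t + 2 * c₂ * (suc (mem s) ∸ memOld s)   ≤⟨ +-mono-≤ t≤ (*-monoʳ-≤ (2 * c₂) (suc-∸-≤ (mem s) (memOld s))) ⟩
  c₁ + 2 * c₂ * suc (mem s ∸ memOld s)    ≡⟨ cong (c₁ +_) (*-suc (2 * c₂) _) ⟩
  c₁ + (2 * c₂ + potential c₂ s)          ≡⟨ shuffle c₁ (2 * c₂) _ ⟩
  potential c₂ s + (c₁ + 2 * c₂)          ∎
  where
  open ≤-Reasoning
  shuffle : ∀ a b c → a + (b + c) ≡ c + (a + b)
  shuffle = solve-∀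
... | true = begin
  t + 2 * c₂ * (L ∸ L)                    ≡⟨ cong (λ k → t + 2 * c₂ * k) (n∸n≡0 L) ⟩
  t + 2 * c₂ * 0                          ≡⟨ trans (cong (t +_) (*-zeroʳ (2 * c₂))) (+-identityʳ t) ⟩
  t                                       ≤⟨ t≤ ⟩
  c₂ * suc (mem s)                        ≡⟨ gc-cost c₂ (mem s) (memOld s) (≡ᵇ-true⇒≡ {suc (mem s)} gc) ⟩
  potential c₂ s + 2 * c₂                 ≤⟨ +-monoʳ-≤ (potential c₂ s) (m≤n+m (2 * c₂) c₁) ⟩
  potential c₂ s + (c₁ + 2 * c₂)          ∎
  where
  open ≤-Reasoning
  L = length (filter (inHlt? (addEdge (tree s) x y) (y ∷ active s) h) (y ∷ memory s))

module _ (c₁ c₂ h x₀ ℓ : ℕ) (op : ℕ → Op) (time : ℕ → ℕ) (ok : CostOK c₁ c₂ h x₀ ℓ op time) where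

  private
    S = stateAt h x₀ op
    Φ = potential c₂
    c = c₁ + 2 * c₂

  amortized-sum : ∀ n → n ≤ ℓ → sumTo time n + Φ (S n) ≤ c * n
  amortized-sum zero _ rewrite *-zeroʳ (2 * c₂) | *-zeroʳ c = z≤n
  amortized-sum (suc n) n<ℓ = begin
    sumTo time n + time n + Φ (S (suc n))   ≡⟨ +-assoc (sumTo time n) (time n) _ ⟩
    sumTo time n + (time n + Φ (S (suc n))) ≤⟨ +-monoʳ-≤ (sumTo time n) step-n ⟩
    sumTo time n + (Φ (S n) + c)            ≡⟨ +-assoc (sumTo time n) _ c ⟨
    sumTo time n + Φ (S n) + c              ≤⟨ +-monoˡ-≤ c (amortized-sum n (<⇒≤ n<ℓ)) ⟩
    c * n + c                               ≡⟨ +-comm (c * n) c ⟩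
    c + c * n                               ≡⟨ *-suc c n ⟨
    c * suc n                               ∎
    where
    open ≤-Reasoning
    step-n = amortized-step h c₁ c₂ (S n) (op n) (time n) (ok n n<ℓ)

  running-time-≤ : sumTo time ℓ ≤ c * ℓ
  running-time-≤ = ≤-trans (m≤m+n (sumTo time ℓ) (Φ (S ℓ))) (amortized-sum ℓ ≤-refl)

-- Memory along a run

module Run (h x₀ ℓ : ℕ) (op : ℕ → Op) (valid : Valid (suc h) x₀ ℓ op) where

  S : ℕ → State
  S = stateAt (suc h) x₀ op

  f : ℕ → ℕ
  f = hSize (suc h) x₀ op

  invariant : ∀ k → k ≤ ℓ → Invariant (S k)
  invariant zero    _   = Invariant-init x₀
  invariant (suc k) k<ℓ = Invariant-step h (op k) (invariant k (<⇒≤ k<ℓ)) (valid k k<ℓ)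

  hSize-init-pos : 1 ≤ f 0
  hSize-init-pos = ≤-reflexive (sym (count-accept (inHlt? (mkTree x₀ []) (x₀ ∷ []) (suc h)) (here (Fin.zero , refl)) []))

  memOld-≤-maxTo : ∀ k → k ≤ ℓ → memOld (S k) ≤ maxTo f k
  memOld-≤-maxTo zero    _   = hSize-init-pos
  memOld-≤-maxTo (suc k) k<ℓ with memOld-step h (op k) (invariant k (<⇒≤ k<ℓ)) (valid k k<ℓ)
  ... | inj₁ unchanged = subst (_≤ maxTo f (suc k)) (sym unchanged)
                           (≤-trans (memOld-≤-maxTo k (<⇒≤ k<ℓ)) (m≤m⊔n (maxTo f k) (f (suc k))))
  ... | inj₂ ≤size = ≤-trans ≤size (m≤n⊔m (maxTo f k) (f (suc k)))

  sAmo-≤-2maxTo : ∀ k → k ≤ ℓ → sAmo (suc h) x₀ op k ≤ 2 * maxTo f k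
  sAmo-≤-2maxTo k k≤ℓ = ≤-trans (<⇒≤ (mem<2memOld (invariant k k≤ℓ))) (*-monoʳ-≤ 2 (memOld-≤-maxTo k k≤ℓ))

  hSize-addChild : ∀ {k x y} → op k ≡ addChild x y → suc (f k) ≤ f (suc k)
  hSize-addChild {k} {x} {y} e rewrite e = sizeHltOf-addChild h (S k) x y

  hSize-deactivate-child : ∀ {j x y} → op j ≡ addChild x y → op (suc j) ≡ deactivate x → suc j < ℓ →
    f (suc j) ≤ suc (f (suc (suc j)))
  hSize-deactivate-child {j} {x} {y} e₁ e₂ j+1<ℓ rewrite e₂ | e₁ =
    sizeHltOf-deactivate-child h (invariant j j≤ℓ) (subst (ValidOp (S j)) e₁ (valid j (<-trans (n<1+n j) j+1<ℓ)))
    where j≤ℓ = ≤-trans (n≤1+n j) (<⇒≤ j+1<ℓ)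

  AlmostMax : ℕ → Set
  AlmostMax k = maxTo f k ≤ suc (f k) × 1 ≤ f k

  AlmostMax-addChild : ∀ {k x y} → op k ≡ addChild x y → AlmostMax k → AlmostMax (suc k)
  AlmostMax-addChild e (max≤ , _) =
    ⊔-lub (≤-trans max≤ (≤-trans grow (n≤1+n _))) (n≤1+n _) , ≤-trans (s≤s z≤n) grow
    where grow = hSize-addChild e

  AlmostMax-deactivate-child : ∀ {j x y} → op j ≡ addChild x y → op (suc j) ≡ deactivate x → suc j < ℓ →
    AlmostMax j → AlmostMax (suc (suc j))
  AlmostMax-deactivate-child e₁ e₂ j+1<ℓ (max≤ , pos) =
    ⊔-lub (⊔-lub (≤-trans max≤ (≤-trans grow shrink)) shrink) (n≤1+n _) ,
    ≤-trans pos (s≤s⁻¹ (≤-trans grow shrink))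
    where
    grow = hSize-addChild e₁
    shrink = hSize-deactivate-child e₁ e₂ j+1<ℓ

  almostMax : Extensive ℓ op → ∀ k → k ≤ ℓ → AlmostMax k
  almostMax _ zero _ = n≤1+n (f 0) , hSize-init-pos
  almostMax extensive (suc k) k<ℓ = by-op (op k) refl
    where
    by-op : ∀ o → op k ≡ o → AlmostMax (suc k)
    by-op (addChild x y) e = AlmostMax-addChild e (almostMax extensive k (<⇒≤ k<ℓ))
    by-op (deactivate x) e with extensive k x k<ℓ e
    ... | j , refl , y , e₁ =
      AlmostMax-deactivate-child e₁ e k<ℓ (almostMax extensive j (≤-trans (n≤1+n j) (<⇒≤ k<ℓ)))

  sAmo-≤-4hSize : Extensive ℓ op → ∀ k → k ≤ ℓ → sAmo (suc h) x₀ op k ≤ 4 * f k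
  sAmo-≤-4hSize extensive k k≤ℓ with almostMax extensive k k≤ℓ
  ... | max≤ , pos = begin
    sAmo (suc h) x₀ op k   ≤⟨ sAmo-≤-2maxTo k k≤ℓ ⟩
    2 * maxTo f k          ≤⟨ *-monoʳ-≤ 2 max≤ ⟩
    2 * suc (f k)          ≤⟨ *-monoʳ-≤ 2 (+-monoˡ-≤ (f k) pos) ⟩
    2 * (f k + f k)        ≡⟨ cong (λ n → 2 * (f k + n)) (+-identityʳ (f k)) ⟨
    2 * (2 * f k)          ≡⟨ *-assoc 2 2 (f k) ⟨
    4 * f k                ∎
    where open ≤-Reasoning

theorem1 : (h : ℕ) → 1 ≤ h → (c₁ c₂ : ℕ) →
    Σ ℕ λ c → Σ ℕ λ C → (0 < c) × (0 < C) ×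
      ((x₀ ℓ : ℕ) (op : ℕ → Op) → Valid h x₀ ℓ op →
        ((time : ℕ → ℕ) → CostOK c₁ c₂ h x₀ ℓ op time → sumTo time ℓ ≤ c * ℓ)
        × ((k : ℕ) → k ≤ ℓ → sAmo h x₀ op k ≤ C * maxTo (hSize h x₀ op) k)
        × (Extensive ℓ op → (k : ℕ) → k ≤ ℓ → sAmo h x₀ op k ≤ C * hSize h x₀ op k))
theorem1 (suc h) _ c₁ c₂ = suc (c₁ + 2 * c₂) , 4 , z<s , z<s , λ x₀ ℓ op valid →
  let open Run h x₀ ℓ op valid in
    (λ time ok → ≤-trans (running-time-≤ c₁ c₂ (suc h) x₀ ℓ op time ok)
                         (*-monoˡ-≤ ℓ (n≤1+n (c₁ + 2 * c₂))))
  , (λ k k≤ℓ → ≤-trans (sAmo-≤-2maxTo k k≤ℓ) (*-monoˡ-≤ (maxTo f k) {2} {4} (s≤s (s≤s z≤n))))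
  , sAmo-≤-4hSize
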